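{- Every typable term of $\lambda\mathbf{J}^{\mathbf{mse}}$ is strongly normalising, i.e. if $\Gamma\vdash t:A$ is derivable then there is no infinite reduction sequence $t\rightarrow t_1\rightarrow t_2\rightarrow\cdots$.
   Context: Types: $A,B,C::= X\mid A\supset B$ with $X$ ranging over type variables. The calculus $\lambda\mathbf{J}^{\mathbf{mse}}$: terms $t,u,v::= x\mid \lambda x.t\mid \{c\}$; co-terms $l::= []\mid u::l\mid (x)c$; commands $c::= t\,l$. $\lambda x$ binds $x$ in $t$, $(x)$ binds $x$ in $c$; $[t/x]T$ is capture-avoiding substitution. Evaluation contexts $E::=[]\mid u::l$. Append: $[]@l'=l'$, $(u::l)@l'=u::(l@l')$, $((x)\,t\,l)@l'=(x)\,t\,(l@l')$. Reduction $\rightarrow$ is the compatible closure of: $(\lambda x.t)(u::l)\rightarrow u\,((x)\,t\,l)$; $\{t\,l\}\,E\rightarrow t\,(l@E)$; $t\,(x)c\rightarrow [t/x]c$; $(x)\,x\,l\rightarrow l$ if $x\notin l$; $\{t\,[]\}\rightarrow t$. Typing judgements $\Gamma\vdash t:A$, $\Gamma\mid l:A\vdash B$, $c:(\Gamma\vdash B)$ ($\Gamma$ a finite set of declarations $x:A$ with distinct variables), generated by: $\Gamma\mid []:A\vdash A$; $\Gamma,x:A\vdash x:A$; from $\Gamma\vdash u:A$ and $\Gamma\mid l:B\vdash C$ infer $\Gamma\mid u::l:A\supset B\vdash C$; from $\Gamma,x:A\vdash t:B$ infer $\Gamma\vdash\lambda x.t:A\supset B$; from $c:(\Gamma,x:A\vdash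 B)$ infer $\Gamma\mid (x)c:A\vdash B$; from $c:(\Gamma\vdash A)$ infer $\Gamma\vdash\{c\}:A$; from $\Gamma\vdash t:A$ and $\Gamma\mid l:A\vdash B$ infer $t\,l:(\Gamma\vdash B)$. A term $t$ is typable if $\Gamma\vdash t:A$ for some $\Gamma,A$. -}

module Defs where

open import Data.Nat using (ℕ; zero; suc)
open import Data.Fin using (Fin; zero; suc)
open import Data.Vec using (Vec; lookup; _∷_)
open import Data.Product using (Σ; _×_)
open import Relation.Binary.PropositionalEquality using (_≡_)
open import Relation.Nullary using (¬_)

data Ty : Set where
  tvar : ℕ → Ty
  _⊃_  : Ty → Ty → Ty

infixr 5 _⊃_

-- Well-scoped de Bruijn syntax of λJ^mse: n = number of free variables in scope.
mutual
  data Tm (n : ℕ) : Set where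
    var   : Fin n → Tm n
    lam   : Tm (suc n) → Tm n
    brace : Cmd n → Tm n

  -- co-terms  l ::= [] | u :: l | (x)c
  data Co (n : ℕ) : Set where
    nil  : Co n
    cons : Tm n → Co n → Co n
    mu   : Cmd (suc n) → Co n

  data Cmd (n : ℕ) : Set where
    cut : Tm n → Co n → Cmd n

ext : ∀ {n m} → (Fin n → Fin m) → Fin (suc n) → Fin (suc m)
ext ρ zero    = zero
ext ρ (suc i) = suc (ρ i)

mutual
  renT : ∀ {n m} → (Fin n → Fin m) → Tm n → Tm m
  renT ρ (var i)   = var (ρ i)
  renT ρ (lam t)   = lam (renT (ext ρ) t)
  renT ρ (brace c) = brace (renC ρ c)

  renL : ∀ {n m} → (Fin n → Fin m) → Co n → Co m
  renL ρ nil        = nil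
  renL ρ (cons u l) = cons (renT ρ u) (renL ρ l)
  renL ρ (mu c)     = mu (renC (ext ρ) c)

  renC : ∀ {n m} → (Fin n → Fin m) → Cmd n → Cmd m
  renC ρ (cut t l) = cut (renT ρ t) (renL ρ l)

exts : ∀ {n m} → (Fin n → Tm m) → Fin (suc n) → Tm (suc m)
exts σ zero    = var zero
exts σ (suc i) = renT suc (σ i)

mutual
  subT : ∀ {n m} → (Fin n → Tm m) → Tm n → Tm m
  subT σ (var i)   = σ i
  subT σ (lam t)   = lam (subT (exts σ) t)
  subT σ (brace c) = brace (subC σ c)

  subL : ∀ {n m} → (Fin n → Tm m) → Co n → Co m
  subL σ nil        = nil
  subL σ (cons u l) = cons (subT σ u) (subL σ l)
  subL σ (mu c)     = mu (subC (exts σ) c)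

  subC : ∀ {n m} → (Fin n → Tm m) → Cmd n → Cmd m
  subC σ (cut t l) = cut (subT σ t) (subL σ l)

single : ∀ {n} → Tm n → Fin (suc n) → Tm n
single t zero    = t
single t (suc i) = var i

_++_ : ∀ {n} → Co n → Co n → Co n
nil      ++ l' = l'
cons u l ++ l' = cons u (l ++ l')
mu (cut t l) ++ l' = mu (cut t (l ++ renL suc l'))

data IsEval {n : ℕ} : Co n → Set where
  ev-nil  : IsEval nil
  ev-cons : ∀ u l → IsEval (cons u l)

mutual
  data _⟶T_ {n : ℕ} : Tm n → Tm n → Set where
    ε-rule : ∀ t → brace (cut t nil) ⟶T t
    ξ-lam   : ∀ {t t'} → t ⟶T t' → lam t ⟶T lam t'
    ξ-brace : ∀ {c c'} → c ⟶C c' → brace c ⟶T brace c'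

  data _⟶L_ {n : ℕ} : Co n → Co n → Set where
    -- (x) x l → l   if x ∉ l   (x ∉ l  ⇔  l is a weakening)
    η-rule : ∀ l → mu (cut (var zero) (renL suc l)) ⟶L l
    ξ-consˡ : ∀ {u u' l} → u ⟶T u' → cons u l ⟶L cons u' l
    ξ-consʳ : ∀ {u l l'} → l ⟶L l' → cons u l ⟶L cons u l'
    ξ-mu    : ∀ {c c'} → c ⟶C c' → mu c ⟶L mu c'

  data _⟶C_ {n : ℕ} : Cmd n → Cmd n → Set where
    β-rule : ∀ t u l → cut (lam t) (cons u l) ⟶C cut u (mu (cut t (renL suc l)))
    π-rule : ∀ t l E → IsEval E → cut (brace (cut t l)) E ⟶C cut t (l ++ E)
    σ-rule : ∀ t c → cut t (mu c) ⟶C subC (single t) c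
    ξ-cutˡ : ∀ {t t' l} → t ⟶T t' → cut t l ⟶C cut t' l
    ξ-cutʳ : ∀ {t l l'} → l ⟶L l' → cut t l ⟶C cut t l'

infix 4 _⟶T_ _⟶L_ _⟶C_

mutual
  data _⊢T_∶_ {n : ℕ} (Γ : Vec Ty n) : Tm n → Ty → Set where
    ax   : ∀ i → Γ ⊢T var i ∶ lookup Γ i
    ⊃R   : ∀ {t A B} → (A ∷ Γ) ⊢T t ∶ B → Γ ⊢T lam t ∶ (A ⊃ B)
    bra  : ∀ {c A} → Γ ⊢C c ∶ A → Γ ⊢T brace c ∶ A

  data _∣_∶_⊢L_ {n : ℕ} (Γ : Vec Ty n) : Co n → Ty → Ty → Set where
    ax-nil : ∀ {A} → Γ ∣ nil ∶ A ⊢L A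
    ⊃L     : ∀ {u l A B C} → Γ ⊢T u ∶ A → Γ ∣ l ∶ B ⊢L C → Γ ∣ cons u l ∶ (A ⊃ B) ⊢L C
    sel    : ∀ {c A B} → (A ∷ Γ) ⊢C c ∶ B → Γ ∣ mu c ∶ A ⊢L B

  data _⊢C_∶_ {n : ℕ} (Γ : Vec Ty n) : Cmd n → Ty → Set where
    cutR : ∀ {t l A B} → Γ ⊢T t ∶ A → Γ ∣ l ∶ A ⊢L B → Γ ⊢C cut t l ∶ B

SN : ∀ {n} → Tm n → Set
SN {n} t = ¬ (Σ (ℕ → Tm n) λ f → (f 0 ≡ t) × (∀ k → f k ⟶T f (suc k)))

-- Reducibility, set up so that it survives the permutative π-rule. For each type A, the
-- reducible evaluation contexts are [] and, when A = A₁ ⊃ A₂, the u :: l with u reducible at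
-- A₁ and l reducible at A₂; a term is reducible if, under every renaming (so that the notion
-- survives going under binders), it forms a strongly normalising command with each of them,
-- and a co-term is reducible if it does so with every reducible term. The fundamental lemma
-- is proved for co-terms and commands already followed by an arbitrary reducible evaluation
-- context E: this is exactly the shape {t l} E → t (l @ E) produces, so the brace case needs
-- nothing beyond SN of the appended command. Variables are reducible, so the fundamental
-- lemma at the identity substitution makes every typable term reducible, hence SN.

module Submission where

open import Defs
open import Data.Nat using (ℕ; suc)
open import Data.Fin using (Fin; zero; suc)
open import Data.Vec using (Vec; lookup; _∷_)
open import Data.Product using (Σ; _×_; _,_)
open import Data.Unit using (⊤; tt)
open import Data.Empty using (⊥)
open import Function using (_∘_; id; flip)
open import Induction.WellFounded using (Acc; acc; acc-inverse)
open import Induction.InfiniteDescent using (InfiniteDescendingSequenceFrom; descent∧acc⇒unsatisfiable)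
open import Relation.Nullary using (¬_)
open import Relation.Binary.PropositionalEquality
  using (_≡_; _≗_; refl; sym; trans; cong; cong₂; subst; subst₂; module ≡-Reasoning)

private
  variable
    n m k : ℕ
    A B : Ty
    Γ : Vec Ty n

Ren : ℕ → ℕ → Set
Ren n m = Fin n → Fin m

Sub : ℕ → ℕ → Set
Sub n m = Fin n → Tm m

ext-cong : ∀ {ρ ρ' : Ren n m} → ρ ≗ ρ' → ext ρ ≗ ext ρ'
ext-cong h zero    = refl
ext-cong h (suc i) = cong suc (h i)

exts-cong : ∀ {σ σ' : Sub n m} → σ ≗ σ' → exts σ ≗ exts σ'
exts-cong h zero    = refl
exts-cong h (suc i) = cong (renT suc) (h i)

mutual
  renT-cong : ∀ {ρ ρ' : Ren n m} → ρ ≗ ρ' → renT ρ ≗ renT ρ'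
  renT-cong h (var i)   = cong var (h i)
  renT-cong h (lam t)   = cong lam (renT-cong (ext-cong h) t)
  renT-cong h (brace c) = cong brace (renC-cong h c)

  renL-cong : ∀ {ρ ρ' : Ren n m} → ρ ≗ ρ' → renL ρ ≗ renL ρ'
  renL-cong h nil        = refl
  renL-cong h (cons u l) = cong₂ cons (renT-cong h u) (renL-cong h l)
  renL-cong h (mu c)     = cong mu (renC-cong (ext-cong h) c)

  renC-cong : ∀ {ρ ρ' : Ren n m} → ρ ≗ ρ' → renC ρ ≗ renC ρ'
  renC-cong h (cut t l) = cong₂ cut (renT-cong h t) (renL-cong h l)

mutual
  subT-cong : ∀ {σ σ' : Sub n m} → σ ≗ σ' → subT σ ≗ subT σ'
  subT-cong h (var i)   = h i
  subT-cong h (lam t)   = cong lam (subT-cong (exts-cong h) t)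
  subT-cong h (brace c) = cong brace (subC-cong h c)

  subL-cong : ∀ {σ σ' : Sub n m} → σ ≗ σ' → subL σ ≗ subL σ'
  subL-cong h nil        = refl
  subL-cong h (cons u l) = cong₂ cons (subT-cong h u) (subL-cong h l)
  subL-cong h (mu c)     = cong mu (subC-cong (exts-cong h) c)

  subC-cong : ∀ {σ σ' : Sub n m} → σ ≗ σ' → subC σ ≗ subC σ'
  subC-cong h (cut t l) = cong₂ cut (subT-cong h t) (subL-cong h l)

ext-id : ∀ {ρ : Ren n n} → ρ ≗ id → ext ρ ≗ id
ext-id h zero    = refl
ext-id h (suc i) = cong suc (h i)

mutual
  renT-id : ∀ {ρ : Ren n n} → ρ ≗ id → renT ρ ≗ id
  renT-id h (var i)   = cong var (h i)
  renT-id h (lam t)   = cong lam (renT-id (ext-id h) t)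
  renT-id h (brace c) = cong brace (renC-id h c)

  renL-id : ∀ {ρ : Ren n n} → ρ ≗ id → renL ρ ≗ id
  renL-id h nil        = refl
  renL-id h (cons u l) = cong₂ cons (renT-id h u) (renL-id h l)
  renL-id h (mu c)     = cong mu (renC-id (ext-id h) c)

  renC-id : ∀ {ρ : Ren n n} → ρ ≗ id → renC ρ ≗ id
  renC-id h (cut t l) = cong₂ cut (renT-id h t) (renL-id h l)

exts-id : ∀ {σ : Sub n n} → σ ≗ var → exts σ ≗ var
exts-id h zero    = refl
exts-id h (suc i) = cong (renT suc) (h i)

mutual
  subT-id : ∀ {σ : Sub n n} → σ ≗ var → subT σ ≗ id
  subT-id h (var i)   = h i
  subT-id h (lam t)   = cong lam (subT-id (exts-id h) t)
  subT-id h (brace c) = cong brace (subC-id h c)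

  subL-id : ∀ {σ : Sub n n} → σ ≗ var → subL σ ≗ id
  subL-id h nil        = refl
  subL-id h (cons u l) = cong₂ cons (subT-id h u) (subL-id h l)
  subL-id h (mu c)     = cong mu (subC-id (exts-id h) c)

  subC-id : ∀ {σ : Sub n n} → σ ≗ var → subC σ ≗ id
  subC-id h (cut t l) = cong₂ cut (subT-id h t) (subL-id h l)

ext-∘ : ∀ (ρ' : Ren m k) (ρ : Ren n m) → ext ρ' ∘ ext ρ ≗ ext (ρ' ∘ ρ)
ext-∘ ρ' ρ zero    = refl
ext-∘ ρ' ρ (suc i) = refl

mutual
  renT-∘ : ∀ (ρ' : Ren m k) (ρ : Ren n m) t → renT ρ' (renT ρ t) ≡ renT (ρ' ∘ ρ) t
  renT-∘ ρ' ρ (var i)   = refl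
  renT-∘ ρ' ρ (lam t)   = cong lam (trans (renT-∘ (ext ρ') (ext ρ) t) (renT-cong (ext-∘ ρ' ρ) t))
  renT-∘ ρ' ρ (brace c) = cong brace (renC-∘ ρ' ρ c)

  renL-∘ : ∀ (ρ' : Ren m k) (ρ : Ren n m) l → renL ρ' (renL ρ l) ≡ renL (ρ' ∘ ρ) l
  renL-∘ ρ' ρ nil        = refl
  renL-∘ ρ' ρ (cons u l) = cong₂ cons (renT-∘ ρ' ρ u) (renL-∘ ρ' ρ l)
  renL-∘ ρ' ρ (mu c)     = cong mu (trans (renC-∘ (ext ρ') (ext ρ) c) (renC-cong (ext-∘ ρ' ρ) c))

  renC-∘ : ∀ (ρ' : Ren m k) (ρ : Ren n m) c → renC ρ' (renC ρ c) ≡ renC (ρ' ∘ ρ) c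
  renC-∘ ρ' ρ (cut t l) = cong₂ cut (renT-∘ ρ' ρ t) (renL-∘ ρ' ρ l)

renT-ext-suc : ∀ (ρ : Ren n m) t → renT (ext ρ) (renT suc t) ≡ renT suc (renT ρ t)
renT-ext-suc ρ t = trans (renT-∘ (ext ρ) suc t) (sym (renT-∘ suc ρ t))

renL-ext-suc : ∀ (ρ : Ren n m) l → renL (ext ρ) (renL suc l) ≡ renL suc (renL ρ l)
renL-ext-suc ρ l = trans (renL-∘ (ext ρ) suc l) (sym (renL-∘ suc ρ l))

exts-renT : ∀ (ρ : Ren m k) (σ : Sub n m) → renT (ext ρ) ∘ exts σ ≗ exts (renT ρ ∘ σ)
exts-renT ρ σ zero    = refl
exts-renT ρ σ (suc i) = renT-ext-suc ρ (σ i)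

mutual
  renT-subT : ∀ (ρ : Ren m k) (σ : Sub n m) t → renT ρ (subT σ t) ≡ subT (renT ρ ∘ σ) t
  renT-subT ρ σ (var i)   = refl
  renT-subT ρ σ (lam t)   = cong lam (trans (renT-subT (ext ρ) (exts σ) t) (subT-cong (exts-renT ρ σ) t))
  renT-subT ρ σ (brace c) = cong brace (renC-subC ρ σ c)

  renL-subL : ∀ (ρ : Ren m k) (σ : Sub n m) l → renL ρ (subL σ l) ≡ subL (renT ρ ∘ σ) l
  renL-subL ρ σ nil        = refl
  renL-subL ρ σ (cons u l) = cong₂ cons (renT-subT ρ σ u) (renL-subL ρ σ l)
  renL-subL ρ σ (mu c)     = cong mu (trans (renC-subC (ext ρ) (exts σ) c) (subC-cong (exts-renT ρ σ) c))

  renC-subC : ∀ (ρ : Ren m k) (σ : Sub n m) c → renC ρ (subC σ c) ≡ subC (renT ρ ∘ σ) c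
  renC-subC ρ σ (cut t l) = cong₂ cut (renT-subT ρ σ t) (renL-subL ρ σ l)

exts-ext : ∀ (σ : Sub m k) (ρ : Ren n m) → exts σ ∘ ext ρ ≗ exts (σ ∘ ρ)
exts-ext σ ρ zero    = refl
exts-ext σ ρ (suc i) = refl

mutual
  subT-renT : ∀ (σ : Sub m k) (ρ : Ren n m) t → subT σ (renT ρ t) ≡ subT (σ ∘ ρ) t
  subT-renT σ ρ (var i)   = refl
  subT-renT σ ρ (lam t)   = cong lam (trans (subT-renT (exts σ) (ext ρ) t) (subT-cong (exts-ext σ ρ) t))
  subT-renT σ ρ (brace c) = cong brace (subC-renC σ ρ c)

  subL-renL : ∀ (σ : Sub m k) (ρ : Ren n m) l → subL σ (renL ρ l) ≡ subL (σ ∘ ρ) l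
  subL-renL σ ρ nil        = refl
  subL-renL σ ρ (cons u l) = cong₂ cons (subT-renT σ ρ u) (subL-renL σ ρ l)
  subL-renL σ ρ (mu c)     = cong mu (trans (subC-renC (exts σ) (ext ρ) c) (subC-cong (exts-ext σ ρ) c))

  subC-renC : ∀ (σ : Sub m k) (ρ : Ren n m) c → subC σ (renC ρ c) ≡ subC (σ ∘ ρ) c
  subC-renC σ ρ (cut t l) = cong₂ cut (subT-renT σ ρ t) (subL-renL σ ρ l)

subT-exts-suc : ∀ (σ : Sub n m) t → subT (exts σ) (renT suc t) ≡ renT suc (subT σ t)
subT-exts-suc σ t = trans (subT-renT (exts σ) suc t) (sym (renT-subT suc σ t))

subL-exts-suc : ∀ (σ : Sub n m) l → subL (exts σ) (renL suc l) ≡ renL suc (subL σ l)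
subL-exts-suc σ l = trans (subL-renL (exts σ) suc l) (sym (renL-subL suc σ l))

subT-single-suc : ∀ (s : Tm n) t → subT (single s) (renT suc t) ≡ t
subT-single-suc s t = trans (subT-renT (single s) suc t) (subT-id (λ _ → refl) t)

subL-single-suc : ∀ (s : Tm n) l → subL (single s) (renL suc l) ≡ l
subL-single-suc s l = trans (subL-renL (single s) suc l) (subL-id (λ _ → refl) l)

exts-subT : ∀ (τ : Sub m k) (σ : Sub n m) → subT (exts τ) ∘ exts σ ≗ exts (subT τ ∘ σ)
exts-subT τ σ zero    = refl
exts-subT τ σ (suc i) = subT-exts-suc τ (σ i)

mutual
  subT-subT : ∀ (τ : Sub m k) (σ : Sub n m) t → subT τ (subT σ t) ≡ subT (subT τ ∘ σ) t
  subT-subT τ σ (var i)   = refl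
  subT-subT τ σ (lam t)   = cong lam (trans (subT-subT (exts τ) (exts σ) t) (subT-cong (exts-subT τ σ) t))
  subT-subT τ σ (brace c) = cong brace (subC-subC τ σ c)

  subL-subL : ∀ (τ : Sub m k) (σ : Sub n m) l → subL τ (subL σ l) ≡ subL (subT τ ∘ σ) l
  subL-subL τ σ nil        = refl
  subL-subL τ σ (cons u l) = cong₂ cons (subT-subT τ σ u) (subL-subL τ σ l)
  subL-subL τ σ (mu c)     = cong mu (trans (subC-subC (exts τ) (exts σ) c) (subC-cong (exts-subT τ σ) c))

  subC-subC : ∀ (τ : Sub m k) (σ : Sub n m) c → subC τ (subC σ c) ≡ subC (subT τ ∘ σ) c
  subC-subC τ σ (cut t l) = cong₂ cut (subT-subT τ σ t) (subL-subL τ σ l)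

exts-var : ∀ (ρ : Ren n m) → exts (var ∘ ρ) ≗ var ∘ ext ρ
exts-var ρ zero    = refl
exts-var ρ (suc i) = refl

mutual
  renT-as-subT : ∀ (ρ : Ren n m) t → renT ρ t ≡ subT (var ∘ ρ) t
  renT-as-subT ρ (var i)   = refl
  renT-as-subT ρ (lam t)   = cong lam (trans (renT-as-subT (ext ρ) t) (sym (subT-cong (exts-var ρ) t)))
  renT-as-subT ρ (brace c) = cong brace (renC-as-subC ρ c)

  renL-as-subL : ∀ (ρ : Ren n m) l → renL ρ l ≡ subL (var ∘ ρ) l
  renL-as-subL ρ nil        = refl
  renL-as-subL ρ (cons u l) = cong₂ cons (renT-as-subT ρ u) (renL-as-subL ρ l)
  renL-as-subL ρ (mu c)     = cong mu (trans (renC-as-subC (ext ρ) c) (sym (subC-cong (exts-var ρ) c)))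

  renC-as-subC : ∀ (ρ : Ren n m) c → renC ρ c ≡ subC (var ∘ ρ) c
  renC-as-subC ρ (cut t l) = cong₂ cut (renT-as-subT ρ t) (renL-as-subL ρ l)

renL-++ : ∀ (ρ : Ren n m) (l l' : Co n) → renL ρ (l ++ l') ≡ renL ρ l ++ renL ρ l'
renL-++ ρ nil            l' = refl
renL-++ ρ (cons u l)     l' = cong (cons (renT ρ u)) (renL-++ ρ l l')
renL-++ ρ (mu (cut t l)) l' = cong (mu ∘ cut (renT (ext ρ) t)) (begin
  renL (ext ρ) (l ++ renL suc l')              ≡⟨ renL-++ (ext ρ) l (renL suc l') ⟩
  renL (ext ρ) l ++ renL (ext ρ) (renL suc l') ≡⟨ cong (renL (ext ρ) l ++_) (renL-ext-suc ρ l') ⟩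
  renL (ext ρ) l ++ renL suc (renL ρ l')       ∎)
  where open ≡-Reasoning

subL-++ : ∀ (σ : Sub n m) (l l' : Co n) → subL σ (l ++ l') ≡ subL σ l ++ subL σ l'
subL-++ σ nil            l' = refl
subL-++ σ (cons u l)     l' = cong (cons (subT σ u)) (subL-++ σ l l')
subL-++ σ (mu (cut t l)) l' = cong (mu ∘ cut (subT (exts σ) t)) (begin
  subL (exts σ) (l ++ renL suc l')              ≡⟨ subL-++ (exts σ) l (renL suc l') ⟩
  subL (exts σ) l ++ subL (exts σ) (renL suc l') ≡⟨ cong (subL (exts σ) l ++_) (subL-exts-suc σ l') ⟩
  subL (exts σ) l ++ renL suc (subL σ l')        ∎)
  where open ≡-Reasoning

++-assoc : ∀ (l l' l'' : Co n) → (l ++ l') ++ l'' ≡ l ++ (l' ++ l'')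
++-assoc nil            l' l'' = refl
++-assoc (cons u l)     l' l'' = cong (cons u) (++-assoc l l' l'')
++-assoc (mu (cut t l)) l' l'' = cong (mu ∘ cut t)
  (trans (++-assoc l (renL suc l') (renL suc l'')) (cong (l ++_) (sym (renL-++ suc l' l''))))

_++ᶜ_ : Cmd n → Co n → Cmd n
cut t l ++ᶜ E = cut t (l ++ E)

infixl 5 _++ᶜ_

renC-++ᶜ : ∀ (ρ : Ren n m) (c : Cmd n) E → renC ρ (c ++ᶜ E) ≡ renC ρ c ++ᶜ renL ρ E
renC-++ᶜ ρ (cut t l) E = cong (cut (renT ρ t)) (renL-++ ρ l E)

subC-++ᶜ : ∀ (σ : Sub n m) (c : Cmd n) E → subC σ (c ++ᶜ E) ≡ subC σ c ++ᶜ subL σ E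
subC-++ᶜ σ (cut t l) E = cong (cut (subT σ t)) (subL-++ σ l E)

subL-IsEval : ∀ (σ : Sub n m) {E : Co n} → IsEval E → IsEval (subL σ E)
subL-IsEval σ ev-nil        = ev-nil
subL-IsEval σ (ev-cons u l) = ev-cons (subT σ u) (subL σ l)

renL-IsEval : ∀ (ρ : Ren n m) {E : Co n} → IsEval E → IsEval (renL ρ E)
renL-IsEval ρ ev-nil        = ev-nil
renL-IsEval ρ (ev-cons u l) = ev-cons (renT ρ u) (renL ρ l)

++-IsEval : ∀ {E E' : Co n} → IsEval E → IsEval E' → IsEval (E ++ E')
++-IsEval ev-nil        ev' = ev'
++-IsEval (ev-cons u l) ev' = ev-cons u (l ++ _)

IsEval-⟶ : ∀ {E E' : Co n} → IsEval E → E ⟶L E' → IsEval E'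
IsEval-⟶ (ev-cons u l) (ξ-consˡ p) = ev-cons _ l
IsEval-⟶ (ev-cons u l) (ξ-consʳ p) = ev-cons u _

subC-single-exts : ∀ (σ : Sub n m) t (c : Cmd (suc n)) →
                   subC (single (subT σ t)) (subC (exts σ) c) ≡ subC σ (subC (single t) c)
subC-single-exts σ t c = begin
  subC (single (subT σ t)) (subC (exts σ) c)    ≡⟨ subC-subC (single (subT σ t)) (exts σ) c ⟩
  subC (subT (single (subT σ t)) ∘ exts σ) c    ≡⟨ subC-cong single-subT-exts c ⟩
  subC (subT σ ∘ single t) c                    ≡⟨ sym (subC-subC σ (single t) c) ⟩
  subC σ (subC (single t) c)                    ∎
  where
  open ≡-Reasoning
  single-subT-exts : subT (single (subT σ t)) ∘ exts σ ≗ subT σ ∘ single t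
  single-subT-exts zero    = refl
  single-subT-exts (suc i) = subT-single-suc (subT σ t) (σ i)

mutual
  subT-⟶ : ∀ (σ : Sub n m) {t t'} → t ⟶T t' → subT σ t ⟶T subT σ t'
  subT-⟶ σ (ε-rule t)  = ε-rule (subT σ t)
  subT-⟶ σ (ξ-lam p)   = ξ-lam (subT-⟶ (exts σ) p)
  subT-⟶ σ (ξ-brace p) = ξ-brace (subC-⟶ σ p)

  subL-⟶ : ∀ (σ : Sub n m) {l l'} → l ⟶L l' → subL σ l ⟶L subL σ l'
  subL-⟶ σ (η-rule l) rewrite subL-exts-suc σ l = η-rule (subL σ l)
  subL-⟶ σ (ξ-consˡ p) = ξ-consˡ (subT-⟶ σ p)
  subL-⟶ σ (ξ-consʳ p) = ξ-consʳ (subL-⟶ σ p)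
  subL-⟶ σ (ξ-mu p)    = ξ-mu (subC-⟶ (exts σ) p)

  subC-⟶ : ∀ (σ : Sub n m) {c c'} → c ⟶C c' → subC σ c ⟶C subC σ c'
  subC-⟶ σ (β-rule t u l) rewrite subL-exts-suc σ l = β-rule _ _ _
  subC-⟶ σ (π-rule t l E ev) rewrite subL-++ σ l E = π-rule _ _ _ (subL-IsEval σ ev)
  subC-⟶ σ (σ-rule t c) rewrite sym (subC-single-exts σ t c) = σ-rule _ _
  subC-⟶ σ (ξ-cutˡ p)   = ξ-cutˡ (subT-⟶ σ p)
  subC-⟶ σ (ξ-cutʳ p)   = ξ-cutʳ (subL-⟶ σ p)

renT-⟶ : ∀ (ρ : Ren n m) {t t'} → t ⟶T t' → renT ρ t ⟶T renT ρ t'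
renT-⟶ ρ {t} {t'} p =
  subst₂ _⟶T_ (sym (renT-as-subT ρ t)) (sym (renT-as-subT ρ t')) (subT-⟶ (var ∘ ρ) p)

renL-⟶ : ∀ (ρ : Ren n m) {l l'} → l ⟶L l' → renL ρ l ⟶L renL ρ l'
renL-⟶ ρ {l} {l'} p =
  subst₂ _⟶L_ (sym (renL-as-subL ρ l)) (sym (renL-as-subL ρ l')) (subL-⟶ (var ∘ ρ) p)

mutual
  ++-⟶ˡ : ∀ {l l' E : Co n} → l ⟶L l' → IsEval E → l ++ E ⟶L l' ++ E
  ++-⟶ˡ {E = E} (η-rule l) ev rewrite sym (renL-++ suc l E) = η-rule (l ++ E)
  ++-⟶ˡ (ξ-consˡ p) ev = ξ-consˡ p
  ++-⟶ˡ (ξ-consʳ p) ev = ξ-consʳ (++-⟶ˡ p ev)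
  ++-⟶ˡ (ξ-mu {cut _ _} {cut _ _} p) ev = ξ-mu (++ᶜ-⟶ p (renL-IsEval suc ev))

  ++ᶜ-⟶ : ∀ {c c' : Cmd n} {E : Co n} → c ⟶C c' → IsEval E → c ++ᶜ E ⟶C c' ++ᶜ E
  ++ᶜ-⟶ {E = E} (β-rule t u l) ev rewrite sym (renL-++ suc l E) = β-rule t u (l ++ E)
  ++ᶜ-⟶ {E = E} (π-rule t l E' ev') ev rewrite ++-assoc l E' E = π-rule t l (E' ++ E) (++-IsEval ev' ev)
  ++ᶜ-⟶ {E = E} (σ-rule t c@(cut _ _)) ev = subst (cut t (mu c ++ E) ⟶C_)
    (trans (subC-++ᶜ (single t) c (renL suc E)) (cong (subC (single t) c ++ᶜ_) (subL-single-suc t E)))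
    (σ-rule t (c ++ᶜ renL suc E))
  ++ᶜ-⟶ (ξ-cutˡ p) ev = ξ-cutˡ p
  ++ᶜ-⟶ (ξ-cutʳ p) ev = ξ-cutʳ (++-⟶ˡ p ev)

++-⟶ʳ : ∀ {E E' : Co n} → E ⟶L E' → ∀ l → l ++ E ⟶L l ++ E'
++-⟶ʳ p nil            = p
++-⟶ʳ p (cons u l)     = ξ-consʳ (++-⟶ʳ p l)
++-⟶ʳ p (mu (cut t l)) = ξ-mu (ξ-cutʳ (++-⟶ʳ (renL-⟶ suc p) l))

SNt : Tm n → Set
SNt = Acc (flip _⟶T_)

SNl : Co n → Set
SNl = Acc (flip _⟶L_)

SNc : Cmd n → Set
SNc = Acc (flip _⟶C_)

SNc-cut⇒SNt : ∀ {t : Tm n} {l} → SNc (cut t l) → SNt t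
SNc-cut⇒SNt (acc rs) = acc λ p → SNc-cut⇒SNt (rs (ξ-cutˡ p))

SNc-cut⇒SNl : ∀ {t : Tm n} {l} → SNc (cut t l) → SNl l
SNc-cut⇒SNl (acc rs) = acc λ p → SNc-cut⇒SNl (rs (ξ-cutʳ p))

SNl-renL⁻ : ∀ (ρ : Ren n m) {l} → SNl (renL ρ l) → SNl l
SNl-renL⁻ ρ (acc rs) = acc λ p → SNl-renL⁻ ρ (rs (renL-⟶ ρ p))

SNc-var-nil : ∀ {i : Fin n} → SNc (cut (var i) nil)
SNc-var-nil = acc λ { (ξ-cutˡ ()) ; (ξ-cutʳ ()) }

SNc-var-cons : ∀ {i : Fin n} {u l} → SNt u → SNl l → SNc (cut (var i) (cons u l))
SNc-var-cons su@(acc rsu) sl@(acc rsl) = acc λ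
  { (ξ-cutˡ ())
  ; (ξ-cutʳ (ξ-consˡ p)) → SNc-var-cons (rsu p) sl
  ; (ξ-cutʳ (ξ-consʳ p)) → SNc-var-cons su (rsl p) }

SNc-lam-nil : ∀ {s : Tm (suc n)} → SNt s → SNc (cut (lam s) nil)
SNc-lam-nil (acc rs) = acc λ { (ξ-cutˡ (ξ-lam p)) → SNc-lam-nil (rs p) ; (ξ-cutʳ ()) }

SNc-lam-cons : ∀ {s : Tm (suc n)} {u l} → SNt s → SNt u → SNl l →
               SNc (cut u (mu (cut s (renL suc l)))) → SNc (cut (lam s) (cons u l))
SNc-lam-cons ss@(acc rss) su@(acc rsu) sl@(acc rsl) sβ@(acc rsβ) = acc λ
  { (β-rule _ _ _)       → sβ
  ; (ξ-cutˡ (ξ-lam p))   → SNc-lam-cons (rss p) su sl (rsβ (ξ-cutʳ (ξ-mu (ξ-cutˡ p))))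
  ; (ξ-cutʳ (ξ-consˡ p)) → SNc-lam-cons ss (rsu p) sl (rsβ (ξ-cutˡ p))
  ; (ξ-cutʳ (ξ-consʳ p)) → SNc-lam-cons ss su (rsl p) (rsβ (ξ-cutʳ (ξ-mu (ξ-cutʳ (renL-⟶ suc p))))) }

SNc-brace : ∀ {c : Cmd n} {E} → IsEval E → SNc (c ++ᶜ E) → SNc (cut (brace c) E)
SNc-brace {c = cut t l} ev h@(acc rs) = acc λ
  { (π-rule _ _ _ _)      → h
  ; (ξ-cutˡ (ε-rule _))   → h
  ; (ξ-cutˡ (ξ-brace p))  → SNc-brace ev (rs (++ᶜ-⟶ p ev))
  ; (ξ-cutʳ p)            → SNc-brace (IsEval-⟶ ev p) (rs (ξ-cutʳ (++-⟶ʳ p l))) }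

mutual
  RedT : Ty → ∀ {n} → Tm n → Set
  RedT A {n} t = ∀ {k} (ρ : Ren n k) (E : Co k) → RedE A E → SNc (cut (renT ρ t) E)

  RedL : Ty → ∀ {n} → Co n → Set
  RedL A {n} l = ∀ {k} (ρ : Ren n k) (t : Tm k) → RedT A t → SNc (cut t (renL ρ l))

  RedE : Ty → ∀ {n} → Co n → Set
  RedE A       nil        = ⊤
  RedE (A ⊃ B) (cons u l) = RedT A u × RedL B l
  RedE _       _          = ⊥

RedT-renT : ∀ (ρ : Ren n m) {t} → RedT A t → RedT A (renT ρ t)
RedT-renT ρ {t} h ρ' E e = subst (λ t' → SNc (cut t' E)) (sym (renT-∘ ρ' ρ t)) (h (ρ' ∘ ρ) E e)

RedL-renL : ∀ (ρ : Ren n m) {l} → RedL A l → RedL A (renL ρ l)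
RedL-renL ρ {l} h ρ' t r = subst (λ l' → SNc (cut t l')) (sym (renL-∘ ρ' ρ l)) (h (ρ' ∘ ρ) t r)

RedE-renL : ∀ A {n m} (ρ : Ren n m) {E} → RedE A E → RedE A (renL ρ E)
RedE-renL A       ρ {nil}      e          = tt
RedE-renL (A ⊃ B) ρ {cons u l} (ru , rl) = RedT-renT ρ ru , RedL-renL ρ rl

RedE⇒IsEval : ∀ A {n} {E : Co n} → RedE A E → IsEval E
RedE⇒IsEval A       {E = nil}      e = ev-nil
RedE⇒IsEval (A ⊃ B) {E = cons u l} e = ev-cons u l

RedT-cut : ∀ {t : Tm n} {E} → RedT A t → RedE A E → SNc (cut t E)
RedT-cut {t = t} {E} h e = subst (λ t' → SNc (cut t' E)) (renT-id (λ _ → refl) t) (h id E e)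

RedL-cut : ∀ {t : Tm n} {l} → RedT A t → RedL A l → SNc (cut t l)
RedL-cut {t = t} {l} r h = subst (λ l' → SNc (cut t l')) (renL-id (λ _ → refl) l) (h id t r)

RedT⇒SNt : ∀ {t : Tm n} → RedT A t → SNt t
RedT⇒SNt h = SNc-cut⇒SNt (RedT-cut h tt)

RedT-⟶ : ∀ {t t' : Tm n} → RedT A t → t ⟶T t' → RedT A t'
RedT-⟶ h p ρ E e = acc-inverse (h ρ E e) (ξ-cutˡ (renT-⟶ ρ p))

RedE⇒RedL : ∀ A {n} {E : Co n} → RedE A E → RedL A E
RedE⇒RedL A e ρ t r = RedT-cut r (RedE-renL A ρ e)

mutual
  RedT-var : ∀ A {n} (i : Fin n) → RedT A (var i)
  RedT-var A       i ρ nil        e          = SNc-var-nil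
  RedT-var (A ⊃ B) i ρ (cons u l) (ru , rl) = SNc-var-cons (RedT⇒SNt ru) (RedL⇒SNl B rl)

  RedL⇒SNl : ∀ A {n} {l : Co n} → RedL A l → SNl l
  RedL⇒SNl A h = SNl-renL⁻ suc (SNc-cut⇒SNl (h suc (var zero) (RedT-var A zero)))

SNc-mu : ∀ {t : Tm n} {c} → RedT A t → SNt t → SNc c →
         (∀ {t'} → RedT A t' → SNc (subC (single t') c)) → SNc (cut t (mu c))
SNc-mu {t = t} rt st@(acc rst) sc@(acc rsc) h = acc λ
  { (σ-rule _ _)        → h rt
  ; (ξ-cutˡ p)          → SNc-mu (RedT-⟶ rt p) (rst p) sc h
  ; (ξ-cutʳ (η-rule l)) → subst (SNc ∘ cut t) (subL-single-suc t l) (h rt)  -- the η-reduct t l is [t/x](x l)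
  ; (ξ-cutʳ (ξ-mu p))   → SNc-mu rt st (rsc p) (λ rt' → acc-inverse (h rt') (subC-⟶ _ p)) }

RedL-mu : ∀ {c : Cmd (suc n)} →
          (∀ {k} (ρ : Ren n k) → SNc (renC (ext ρ) c)) →
          (∀ {k} (ρ : Ren n k) {u} → RedT A u → SNc (subC (single u) (renC (ext ρ) c))) →
          RedL A (mu c)
RedL-mu sn inst ρ t r = SNc-mu r (RedT⇒SNt r) (sn ρ) (inst ρ)

RedT-lam : ∀ {s : Tm (suc n)} → RedT B s →
           (∀ {k} (ρ : Ren n k) {u} → RedT A u → RedT B (subT (single u) (renT (ext ρ) s))) →
           RedT (A ⊃ B) (lam s)
RedT-lam rs inst ρ nil        e          = SNc-lam-nil (RedT⇒SNt (RedT-renT (ext ρ) rs))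
RedT-lam {B = B} {s = s} rs inst ρ (cons u l) (ru , rl) =
  SNc-lam-cons (RedT⇒SNt rs') (RedT⇒SNt ru) (RedL⇒SNl B rl)
    (SNc-mu ru (RedT⇒SNt ru) (rl suc s' rs') λ {u'} ru' →
      subst (SNc ∘ cut _) (sym (subL-single-suc u' l)) (RedL-cut (inst ρ ru') rl))
  where
  s' : Tm (suc _)
  s' = renT (ext ρ) s
  rs' : RedT B s'
  rs' = RedT-renT (ext ρ) rs

_∷ˢ_ : Tm m → Sub n m → Sub (suc n) m
(u ∷ˢ σ) zero    = u
(u ∷ˢ σ) (suc i) = σ i

single-ext-exts : ∀ (u : Tm k) (ρ : Ren m k) (σ : Sub n m) →
                  subT (single u) ∘ renT (ext ρ) ∘ exts σ ≗ u ∷ˢ (renT ρ ∘ σ)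
single-ext-exts u ρ σ zero    = refl
single-ext-exts u ρ σ (suc i) =
  trans (cong (subT (single u)) (renT-ext-suc ρ (σ i))) (subT-single-suc u (renT ρ (σ i)))

subT-single-ext-exts : ∀ (u : Tm k) (ρ : Ren m k) (σ : Sub n m) t →
                       subT (single u) (renT (ext ρ) (subT (exts σ) t)) ≡ subT (u ∷ˢ (renT ρ ∘ σ)) t
subT-single-ext-exts u ρ σ t = begin
  subT (single u) (renT (ext ρ) (subT (exts σ) t))  ≡⟨ cong (subT (single u)) (renT-subT (ext ρ) (exts σ) t) ⟩
  subT (single u) (subT (renT (ext ρ) ∘ exts σ) t)  ≡⟨ subT-subT (single u) (renT (ext ρ) ∘ exts σ) t ⟩
  subT (subT (single u) ∘ renT (ext ρ) ∘ exts σ) t  ≡⟨ subT-cong (single-ext-exts u ρ σ) t ⟩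
  subT (u ∷ˢ (renT ρ ∘ σ)) t                        ∎
  where open ≡-Reasoning

subC-single-ext-exts : ∀ (u : Tm k) (ρ : Ren m k) (σ : Sub n m) c →
                       subC (single u) (renC (ext ρ) (subC (exts σ) c)) ≡ subC (u ∷ˢ (renT ρ ∘ σ)) c
subC-single-ext-exts u ρ σ c = begin
  subC (single u) (renC (ext ρ) (subC (exts σ) c))  ≡⟨ cong (subC (single u)) (renC-subC (ext ρ) (exts σ) c) ⟩
  subC (single u) (subC (renT (ext ρ) ∘ exts σ) c)  ≡⟨ subC-subC (single u) (renT (ext ρ) ∘ exts σ) c ⟩
  subC (subT (single u) ∘ renT (ext ρ) ∘ exts σ) c  ≡⟨ subC-cong (single-ext-exts u ρ σ) c ⟩
  subC (u ∷ˢ (renT ρ ∘ σ)) c                        ∎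
  where open ≡-Reasoning

renC-ext-mu-body : ∀ (ρ : Ren m k) (σ : Sub n m) c E →
                   renC (ext ρ) (subC (exts σ) c ++ᶜ renL suc E)
                     ≡ subC (exts (renT ρ ∘ σ)) c ++ᶜ renL suc (renL ρ E)
renC-ext-mu-body ρ σ c E = begin
  renC (ext ρ) (subC (exts σ) c ++ᶜ renL suc E)
    ≡⟨ renC-++ᶜ (ext ρ) (subC (exts σ) c) (renL suc E) ⟩
  renC (ext ρ) (subC (exts σ) c) ++ᶜ renL (ext ρ) (renL suc E)
    ≡⟨ cong₂ _++ᶜ_ (renC-subC (ext ρ) (exts σ) c) (renL-ext-suc ρ E) ⟩
  subC (renT (ext ρ) ∘ exts σ) c ++ᶜ renL suc (renL ρ E)
    ≡⟨ cong (_++ᶜ renL suc (renL ρ E)) (subC-cong (exts-renT ρ σ) c) ⟩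
  subC (exts (renT ρ ∘ σ)) c ++ᶜ renL suc (renL ρ E)
    ∎
  where open ≡-Reasoning

subC-single-ext-mu-body : ∀ (u : Tm k) (ρ : Ren m k) (σ : Sub n m) c E →
                          subC (single u) (renC (ext ρ) (subC (exts σ) c ++ᶜ renL suc E))
                            ≡ subC (u ∷ˢ (renT ρ ∘ σ)) c ++ᶜ renL ρ E
subC-single-ext-mu-body u ρ σ c E = begin
  subC (single u) (renC (ext ρ) (subC (exts σ) c ++ᶜ renL suc E))
    ≡⟨ cong (subC (single u)) (renC-++ᶜ (ext ρ) (subC (exts σ) c) (renL suc E)) ⟩
  subC (single u) (renC (ext ρ) (subC (exts σ) c) ++ᶜ renL (ext ρ) (renL suc E))
    ≡⟨ subC-++ᶜ (single u) (renC (ext ρ) (subC (exts σ) c)) (renL (ext ρ) (renL suc E)) ⟩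
  subC (single u) (renC (ext ρ) (subC (exts σ) c)) ++ᶜ subL (single u) (renL (ext ρ) (renL suc E))
    ≡⟨ cong₂ _++ᶜ_ (subC-single-ext-exts u ρ σ c) (cong (subL (single u)) (renL-ext-suc ρ E)) ⟩
  subC (u ∷ˢ (renT ρ ∘ σ)) c ++ᶜ subL (single u) (renL suc (renL ρ E))
    ≡⟨ cong (subC (u ∷ˢ (renT ρ ∘ σ)) c ++ᶜ_) (subL-single-suc u (renL ρ E)) ⟩
  subC (u ∷ˢ (renT ρ ∘ σ)) c ++ᶜ renL ρ E
    ∎
  where open ≡-Reasoning

RedSub : Vec Ty n → Sub n m → Set
RedSub Γ σ = ∀ i → RedT (lookup Γ i) (σ i)

RedSub-var : ∀ (Γ : Vec Ty n) → RedSub Γ var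
RedSub-var Γ i = RedT-var (lookup Γ i) i

RedSub-renT : ∀ {σ : Sub n m} (ρ : Ren m k) → RedSub Γ σ → RedSub Γ (renT ρ ∘ σ)
RedSub-renT ρ r i = RedT-renT ρ (r i)

RedSub-∷ : ∀ {σ : Sub n m} {u} → RedT A u → RedSub Γ σ → RedSub (A ∷ Γ) (u ∷ˢ σ)
RedSub-∷ ru r zero    = ru
RedSub-∷ ru r (suc i) = r i

RedSub-exts : ∀ {σ : Sub n m} → RedSub Γ σ → RedSub (A ∷ Γ) (exts σ)
RedSub-exts {A = A} r zero    = RedT-var A zero
RedSub-exts         r (suc i) = RedT-renT suc (r i)

mutual
  adequacyT : ∀ {t} → Γ ⊢T t ∶ A → (σ : Sub n m) → RedSub Γ σ → RedT A (subT σ t)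
  adequacyT (ax i)                  σ r = r i
  adequacyT {Γ = Γ} (⊃R {t = t} {B = B} dt) σ r =
    RedT-lam (adequacyT dt (exts σ) (RedSub-exts r)) λ ρ {u} ru → subst (RedT B) (sym (subT-single-ext-exts u ρ σ t))
      (adequacyT dt (u ∷ˢ (renT ρ ∘ σ)) (RedSub-∷ ru (RedSub-renT {Γ = Γ} ρ r)))
  adequacyT {Γ = Γ} (bra {c = c} {A} dc) σ r ρ E e = SNc-brace (RedE⇒IsEval A e)
    (subst (λ c' → SNc (c' ++ᶜ E)) (sym (renC-subC ρ σ c))
      (adequacyC dc (renT ρ ∘ σ) (RedSub-renT {Γ = Γ} ρ r) E e))

  adequacyL : ∀ {l} → Γ ∣ l ∶ A ⊢L B → (σ : Sub n m) → RedSub Γ σ →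
              ∀ E → RedE B E → RedL A (subL σ l ++ E)
  adequacyL (ax-nil {A})         σ r E e = RedE⇒RedL A e
  adequacyL (⊃L {A = A} {B} du dl) σ r E e =
    RedE⇒RedL (A ⊃ B) (adequacyT du σ r , adequacyL dl σ r E e)
  adequacyL {Γ = Γ} (sel {c = c@(cut _ _)} {A} {B} dc) σ r E e = RedL-mu
    (λ ρ → subst SNc (sym (renC-ext-mu-body ρ σ c E))
      (adequacyC dc (exts (renT ρ ∘ σ)) (RedSub-exts (RedSub-renT {Γ = Γ} ρ r))
        (renL suc (renL ρ E)) (RedE-renL B suc (RedE-renL B ρ e))))
    (λ ρ {u} ru → subst SNc (sym (subC-single-ext-mu-body u ρ σ c E))
      (adequacyC dc (u ∷ˢ (renT ρ ∘ σ)) (RedSub-∷ ru (RedSub-renT {Γ = Γ} ρ r))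
        (renL ρ E) (RedE-renL B ρ e)))

  adequacyC : ∀ {c} → Γ ⊢C c ∶ B → (σ : Sub n m) → RedSub Γ σ →
              ∀ E → RedE B E → SNc (subC σ c ++ᶜ E)
  adequacyC (cutR dt dl) σ r E e = RedL-cut (adequacyT dt σ r) (adequacyL dl σ r E e)

acc⇒¬infiniteDescent : ∀ {a r} {X : Set a} {_<_ : X → X → Set r} {x : X} →
                       Acc _<_ x → ¬ Σ (ℕ → X) (λ f → InfiniteDescendingSequenceFrom _<_ f x)
acc⇒¬infiniteDescent {X = X} {_<_} =
  descent∧acc⇒unsatisfiable {P = λ x → Σ (ℕ → X) (λ f → InfiniteDescendingSequenceFrom _<_ f x)}
    λ { (f , refl , desc) → f 1 , desc 0 , f ∘ suc , refl , desc ∘ suc }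

SNt⇒SN : ∀ {t : Tm n} → SNt t → SN t
SNt⇒SN = acc⇒¬infiniteDescent

corollary4p5 : ∀ {n : ℕ} (Γ : Vec Ty n) (t : Tm n) (A : Ty) → Γ ⊢T t ∶ A → SN t
corollary4p5 Γ t A d = SNt⇒SN (subst SNt (subT-id (λ _ → refl) t) (RedT⇒SNt reducible))
  where
  reducible : RedT A (subT var t)
  reducible = adequacyT d var (RedSub-var Γ)
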